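{- For $n\ge1$ and $0\le k\le n$, the value of $c_q[n,k]$ at $q=-1$ equals the number of placements in $\mathcal{AR}(n,n-k)$ in which all rooks lie on shaded squares of row $1$, and $$c_q[n,k]\big|_{q=-1}=\binom{\lfloor n/2\rfloor}{n-k}.$$
   Context: The staircase board of length $n$ consists of squares $(i,j)$, $i,j\ge1$, $i+j\le n$ (row $i$ from the top, column $j$ from the left). Square $(i,j)$ has $n-i-j$ squares below it and is shaded if $n-i-j$ is even. $\mathcal{AR}(n,r)$ is the set of placements of $r$ rooks on shaded squares with no two rooks in the same column. Let $[k]_q=1+q+\dots+q^{k-1}$ ($[0]_q=0$). The unsigned $q$-Stirling numbers of the first kind satisfy $c_q[n,k]=c_q[n-1,k-1]+[n-1]_q\,c_q[n-1,k]$ for $n,k\ge1$, with $c_q[n,0]=\delta_{n,0}$ and $c_q[n,k]=0$ for $k>n$. -}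

module Defs where

open import Data.Nat using (ℕ; zero; suc; _+_; _∸_; _≤ᵇ_; _%_)
open import Data.Nat.Base using (_≡ᵇ_)
open import Data.Integer using (ℤ; +_; -[1+_]) renaming (_+_ to _+ℤ_; _*_ to _*ℤ_)
open import Data.Bool using (Bool; true; false; _∧_)
open import Data.Maybe using (Maybe; just; nothing)
open import Data.Fin using (Fin; toℕ)
open import Data.Vec using (Vec; []; _∷_)
open import Data.List using (List; []; _∷_; map; concatMap; filterᵇ; length)
open import Data.List using () renaming (_∷_ to _∷ˡ_)
open import Data.Fin using () renaming (zero to fzero)
open import Data.List.Base using (allFin)

-- q-integers and unsigned q-Stirling numbers of the first kind,
-- evaluated at an integer value q (the defining recurrence is a ring
-- identity, so evaluating the polynomial at q = -1 gives this value).

-- [k]_q = 1 + q + ... + q^(k-1)   (Horner form), [0]_q = 0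
qint : ℤ → ℕ → ℤ
qint q zero    = + 0
qint q (suc k) = + 1 +ℤ q *ℤ qint q k

cq : ℤ → ℕ → ℕ → ℤ
cq q zero    zero    = + 1
cq q zero    (suc k) = + 0
cq q (suc n) zero    = + 0
cq q (suc n) (suc k) = cq q n k +ℤ qint q n *ℤ cq q n (suc k)

-- A placement with no two rooks in the same column is encoded as a
-- vector indexed by the columns j = 1 .. n: entry j is  nothing  (no rook
-- in column j) or  just r  (a rook in row i = toℕ r + 1 of column j).

Placement : ℕ → Set
Placement n = Vec (Maybe (Fin n)) n

shaded : ℕ → ℕ → ℕ → Bool
shaded n i j = ((i + j) ≤ᵇ n) ∧ (((n ∸ (i + j)) % 2) ≡ᵇ 0)

allShaded : ∀ {m} → (n j : ℕ) → Vec (Maybe (Fin n)) m → Bool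
allShaded n j []             = true
allShaded n j (nothing ∷ p)  = allShaded n (suc j) p
allShaded n j (just r ∷ p)   = shaded n (suc (toℕ r)) j ∧ allShaded n (suc j) p

rooks : ∀ {m n} → Vec (Maybe (Fin n)) m → ℕ
rooks []            = 0
rooks (nothing ∷ p) = rooks p
rooks (just _ ∷ p)  = suc (rooks p)

inRow1 : ∀ {m n} → Vec (Maybe (Fin n)) m → Bool
inRow1 []                 = true
inRow1 (nothing ∷ p)      = inRow1 p
inRow1 (just fzero ∷ p)   = inRow1 p
inRow1 (just (Fin.suc _) ∷ p) = false

inAR : (n r : ℕ) → Placement n → Bool
inAR n r p = allShaded n 1 p ∧ (rooks p ≡ᵇ r)

allVecs : (m n : ℕ) → List (Vec (Maybe (Fin n)) m)
allVecs zero    n = [] ∷ˡ []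
allVecs (suc m) n =
  concatMap (λ x → map (x ∷_) (allVecs m n)) (nothing ∷ˡ map just (allFin n))

countAR-row1 : (n r : ℕ) → ℕ
countAR-row1 n r = length (filterᵇ (λ p → inAR n r p ∧ inRow1 p) (allVecs n n))

-- At q = -1 the q-integer [n] is n mod 2 and ⌊(n+1)/2⌋ = ⌊n/2⌋ + n mod 2, so the
-- recurrence for c[n,k], read in d = n - k, is Pascal's rule for binomials with top
-- entry ⌊n/2⌋: the new factor [n] is 1 exactly when ⌊n/2⌋ grows by one.  On the
-- board side, a placement with every rook in row 1 is a choice of n - k shaded
-- squares of row 1, and (1, j) is shaded iff n - 1 - j is even, which happens for
-- ⌊n/2⌋ columns; scanning the columns left to right gives the same Pascal recursion.
module Submission where

open import Defs
open import Data.Nat using (ℕ; _≤_; _∸_; ⌊_/2⌋)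
open import Data.Nat.Combinatorics using (_C_)
open import Data.Integer using (ℤ; +_; -[1+_])
open import Data.Product using (_×_; _,_)
open import Relation.Binary.PropositionalEquality using (_≡_)

open import Data.Bool using (Bool; true; false; _∧_)
open import Data.Bool.Properties using (∧-zeroʳ)
open import Data.Fin using (Fin) renaming (zero to fzero; suc to fsuc)
open import Data.Integer using (-1ℤ) renaming (_+_ to _+ℤ_; _*_ to _*ℤ_)
open import Data.Integer.Properties using (*-zeroʳ; pos-*)
open import Data.Integer.Tactic.RingSolver using (solve-∀)
open import Data.List using (List; []; _∷_; _++_; map; concatMap; filterᵇ; length; tabulate)
open import Data.List.Properties using (filter-++; length-++)
open import Data.List.Relation.Unary.All using (All; []; _∷_)
open import Data.List.Relation.Unary.All.Properties using (map⁺; tabulate⁺)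
open import Data.Maybe using (Maybe; just; nothing)
open import Data.Nat using (zero; suc; _+_; _*_; _<_; _%_; _≡ᵇ_; s≤s; z≤n)
open import Data.Nat.Combinatorics using (k>n⇒nCk≡0; nCk+nC[k+1]≡[n+1]C[k+1])
open import Data.Nat.DivMod using (m%n<n)
open import Data.Nat.Properties
  using (+-suc; +-comm; +-identityʳ; *-identityˡ; ≤-pred; ≤-reflexive; m+[n∸m]≡n; ⌊n/2⌋<n; m<n⇒m<1+n)
open import Data.Vec using (Vec; _∷_)
open import Function using (_∘_)
open import Relation.Binary.PropositionalEquality
  using (refl; sym; trans; cong; cong₂; subst; module ≡-Reasoning)
open import Relation.Nullary.Decidable using (T?)

open ≡-Reasoning

indicator : Bool → ℕ
indicator true  = 1
indicator false = 0

indicator≤1 : ∀ b → indicator b ≤ 1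
indicator≤1 true  = s≤s z≤n
indicator≤1 false = z≤n

⌊1+n/2⌋≡n%2+⌊n/2⌋ : ∀ n → ⌊ suc n /2⌋ ≡ n % 2 + ⌊ n /2⌋
⌊1+n/2⌋≡n%2+⌊n/2⌋ zero          = refl
⌊1+n/2⌋≡n%2+⌊n/2⌋ (suc zero)    = refl
⌊1+n/2⌋≡n%2+⌊n/2⌋ (suc (suc n)) =
  trans (cong suc (⌊1+n/2⌋≡n%2+⌊n/2⌋ n)) (sym (+-suc (n % 2) ⌊ n /2⌋))

n%2≤1 : ∀ n → n % 2 ≤ 1
n%2≤1 n = ≤-pred (m%n<n n 2)

[b+n]C[1+k]≡nC[1+k]+b*nCk : ∀ {b} → b ≤ 1 → ∀ n k → (b + n) C suc k ≡ n C suc k + b * (n C k)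
[b+n]C[1+k]≡nC[1+k]+b*nCk z≤n       n k = sym (+-identityʳ (n C suc k))
[b+n]C[1+k]≡nC[1+k]+b*nCk (s≤s z≤n) n k = begin
  suc n C suc k            ≡⟨ nCk+nC[k+1]≡[n+1]C[k+1] n k ⟨
  n C k + n C suc k        ≡⟨ +-comm (n C k) (n C suc k) ⟩
  n C suc k + n C k        ≡⟨ cong (_+_ (n C suc k)) (*-identityˡ (n C k)) ⟨
  n C suc k + 1 * (n C k) ∎

qint-−1 : ∀ n → qint -1ℤ n ≡ + (n % 2)
qint-−1 zero          = refl
qint-−1 (suc zero)    = refl
qint-−1 (suc (suc n)) = trans (period (qint -1ℤ n)) (qint-−1 n)
  where
  period : ∀ x → + 1 +ℤ -1ℤ *ℤ (+ 1 +ℤ -1ℤ *ℤ x) ≡ x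
  period = solve-∀

cq-vanish : ∀ q {n k} → n < k → cq q n k ≡ + 0
cq-vanish q {zero}  {suc k} _ = refl
cq-vanish q {suc n} {suc k} (s≤s n<k)
  rewrite cq-vanish q n<k | cq-vanish q (m<n⇒m<1+n n<k) | *-zeroʳ (qint q n) = refl

cq-−1 : ∀ k d → cq -1ℤ (k + d) k ≡ + (⌊ k + d /2⌋ C d)
cq-−1 zero    zero    = refl
cq-−1 zero    (suc d) = cong +_ (sym (k>n⇒nCk≡0 (⌊n/2⌋<n d)))
cq-−1 (suc k) zero    = begin
  cq -1ℤ n k +ℤ qint -1ℤ n *ℤ cq -1ℤ n (suc k)
    ≡⟨ cong₂ (λ a b → a +ℤ qint -1ℤ n *ℤ b) (cq-−1 k zero) (cq-vanish -1ℤ n<1+k) ⟩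
  + 1 +ℤ qint -1ℤ n *ℤ + 0
    ≡⟨ cong (_+ℤ_ (+ 1)) (*-zeroʳ (qint -1ℤ n)) ⟩
  + 1 ∎
  where
  n : ℕ
  n = k + 0
  n<1+k : n < suc k
  n<1+k = s≤s (≤-reflexive (+-identityʳ k))
cq-−1 (suc k) (suc d) = begin
  cq -1ℤ n k +ℤ qint -1ℤ n *ℤ cq -1ℤ n (suc k)
    ≡⟨ cong₂ _+ℤ_ (cq-−1 k (suc d)) (cong₂ _*ℤ_ (qint-−1 n) shifted) ⟩
  + (h C suc d) +ℤ + (n % 2) *ℤ + (h C d)
    ≡⟨ cong (_+ℤ_ (+ (h C suc d))) (pos-* (n % 2) (h C d)) ⟨
  + (h C suc d + n % 2 * (h C d))
    ≡⟨ cong +_ ([b+n]C[1+k]≡nC[1+k]+b*nCk (n%2≤1 n) h d) ⟨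
  + ((n % 2 + h) C suc d)
    ≡⟨ cong (λ m → + (m C suc d)) (⌊1+n/2⌋≡n%2+⌊n/2⌋ n) ⟨
  + (⌊ suc n /2⌋ C suc d) ∎
  where
  n h : ℕ
  n = k + suc d
  h = ⌊ n /2⌋
  shifted : cq -1ℤ n (suc k) ≡ + (h C d)
  shifted = subst (λ m → cq -1ℤ m (suc k) ≡ + (⌊ m /2⌋ C d)) (sym (+-suc k d)) (cq-−1 (suc k) d)

cq-−1-closed : ∀ {n k} → k ≤ n → cq -1ℤ n k ≡ + (⌊ n /2⌋ C (n ∸ k))
cq-−1-closed {n} {k} k≤n =
  subst (λ m → cq -1ℤ m k ≡ + (⌊ m /2⌋ C (n ∸ k))) (m+[n∸m]≡n k≤n) (cq-−1 k (n ∸ k))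

module _ {A : Set} where

  count : (A → Bool) → List A → ℕ
  count p xs = length (filterᵇ p xs)

  count-++ : ∀ p (xs ys : List A) → count p (xs ++ ys) ≡ count p xs + count p ys
  count-++ p xs ys = trans (cong length (filter-++ (T? ∘ p) xs ys)) (length-++ (filterᵇ p xs))

  count-cong : ∀ {p q} → (∀ x → p x ≡ q x) → ∀ xs → count p xs ≡ count q xs
  count-cong p≗q []       = refl
  count-cong {q = q} p≗q (x ∷ xs) rewrite p≗q x with q x
  ... | true  = cong suc (count-cong p≗q xs)
  ... | false = count-cong p≗q xs

  count-none : ∀ {p} → (∀ x → p x ≡ false) → ∀ xs → count p xs ≡ 0
  count-none p≡false []       = refl
  count-none p≡false (x ∷ xs) rewrite p≡false x = count-none p≡false xs

  count-∧ˡ : ∀ b p xs → count (λ x → b ∧ p x) xs ≡ indicator b * count p xs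
  count-∧ˡ true  p xs = sym (*-identityˡ (count p xs))
  count-∧ˡ false p xs = count-none (λ _ → refl) xs

count-map : ∀ {A B : Set} p (f : A → B) xs → count p (map f xs) ≡ count (p ∘ f) xs
count-map p f []       = refl
count-map p f (x ∷ xs) with p (f x)
... | true  = cong suc (count-map p f xs)
... | false = count-map p f xs

consProduct : ∀ {A : Set} {m} → List A → List (Vec A m) → List (Vec A (suc m))
consProduct hs vs = concatMap (λ h → map (h ∷_) vs) hs

module _ {A : Set} {m} (p : Vec A (suc m) → Bool) (vs : List (Vec A m)) where

  count-consProduct-∷ : ∀ h hs →
    count p (consProduct (h ∷ hs) vs) ≡ count (p ∘ (h ∷_)) vs + count p (consProduct hs vs)
  count-consProduct-∷ h hs = trans (count-++ p (map (h ∷_) vs) (consProduct hs vs))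
                                   (cong (_+ count p (consProduct hs vs)) (count-map p (h ∷_) vs))

  count-consProduct-none : ∀ {hs} → All (λ h → ∀ v → p (h ∷ v) ≡ false) hs →
                           count p (consProduct hs vs) ≡ 0
  count-consProduct-none {[]}     []                     = refl
  count-consProduct-none {h ∷ hs} (ph≡false ∷ phs≡false) = begin
    count p (consProduct (h ∷ hs) vs)                   ≡⟨ count-consProduct-∷ h hs ⟩
    count (p ∘ (h ∷_)) vs + count p (consProduct hs vs) ≡⟨ cong₂ _+_ (count-none ph≡false vs)
                                                                     (count-consProduct-none phs≡false) ⟩
    0                                                   ∎

count-allVecs-suc : ∀ {n} m (p : Vec (Maybe (Fin (suc n))) (suc m) → Bool) →
  (∀ i v → p (just (fsuc i) ∷ v) ≡ false) →
  count p (allVecs (suc m) (suc n))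
    ≡ count (p ∘ (nothing ∷_)) (allVecs m (suc n)) + count (p ∘ (just fzero ∷_)) (allVecs m (suc n))
count-allVecs-suc {n} m p rejects = begin
  count p (consProduct (nothing ∷ just fzero ∷ rest) vs)
    ≡⟨ count-consProduct-∷ p vs nothing (just fzero ∷ rest) ⟩
  a + count p (consProduct (just fzero ∷ rest) vs)
    ≡⟨ cong (_+_ a) (count-consProduct-∷ p vs (just fzero) rest) ⟩
  a + (b + count p (consProduct rest vs))
    ≡⟨ cong (λ c → a + (b + c)) (count-consProduct-none p vs (map⁺ (tabulate⁺ rejects))) ⟩
  a + (b + 0)
    ≡⟨ cong (_+_ a) (+-identityʳ b) ⟩
  a + b ∎
  where
  vs : List (Vec (Maybe (Fin (suc n))) m)
  vs = allVecs m (suc n)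
  rest : List (Maybe (Fin (suc n)))
  rest = map just (tabulate fsuc)
  a b : ℕ
  a = count (p ∘ (nothing ∷_)) vs
  b = count (p ∘ (just fzero ∷_)) vs

-- A vector of length m describes the columns j, j+1, ..., j+m-1 of the board of length N.
isRow1Placement : ∀ {m} (N j r : ℕ) → Vec (Maybe (Fin N)) m → Bool
isRow1Placement N j r v = (allShaded N j v ∧ (rooks v ≡ᵇ r)) ∧ inRow1 v

shadedInRow1 : (N j m : ℕ) → ℕ
shadedInRow1 N j zero    = 0
shadedInRow1 N j (suc m) = indicator (shaded N 1 j) + shadedInRow1 N (suc j) m

isRow1Placement-row>1 : ∀ {n m} j r i (v : Vec (Maybe (Fin (suc n))) m) →
  isRow1Placement (suc n) j r (just (fsuc i) ∷ v) ≡ false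
isRow1Placement-row>1 j r i v = ∧-zeroʳ _

isRow1Placement-no-rook : ∀ {n m} j (v : Vec (Maybe (Fin (suc n))) m) →
  isRow1Placement (suc n) j 0 (just fzero ∷ v) ≡ false
isRow1Placement-no-rook {n} j v =
  cong (_∧ inRow1 v) (∧-zeroʳ (shaded (suc n) 1 j ∧ allShaded (suc n) (suc j) v))

isRow1Placement-rook : ∀ {n m} j r (v : Vec (Maybe (Fin (suc n))) m) →
  isRow1Placement (suc n) j (suc r) (just fzero ∷ v)
    ≡ shaded (suc n) 1 j ∧ isRow1Placement (suc n) (suc j) r v
isRow1Placement-rook {n} j r v with shaded (suc n) 1 j
... | true  = refl
... | false = refl

count-isRow1Placement : ∀ {n} m j r →
  count (isRow1Placement (suc n) j r) (allVecs m (suc n)) ≡ shadedInRow1 (suc n) j m C r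
count-isRow1Placement zero    j zero    = refl
count-isRow1Placement zero    j (suc r) = refl
count-isRow1Placement {n} (suc m) j zero = begin
  count (P j 0) (allVecs (suc m) (suc n))
    ≡⟨ count-allVecs-suc m (P j 0) (isRow1Placement-row>1 j 0) ⟩
  count (P (suc j) 0) vs + count (λ v → P j 0 (just fzero ∷ v)) vs
    ≡⟨ cong (_+_ _) (count-none (isRow1Placement-no-rook j) vs) ⟩
  count (P (suc j) 0) vs + 0
    ≡⟨ +-identityʳ _ ⟩
  count (P (suc j) 0) vs
    ≡⟨ count-isRow1Placement m (suc j) 0 ⟩
  1 ∎
  where
  P : ∀ {k} → ℕ → ℕ → Vec (Maybe (Fin (suc n))) k → Bool
  P = isRow1Placement (suc n)
  vs : List (Vec (Maybe (Fin (suc n))) m)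
  vs = allVecs m (suc n)
count-isRow1Placement {n} (suc m) j (suc r) = begin
  count (P j (suc r)) (allVecs (suc m) (suc n))
    ≡⟨ count-allVecs-suc m (P j (suc r)) (isRow1Placement-row>1 j (suc r)) ⟩
  count (P (suc j) (suc r)) vs + count (λ v → P j (suc r) (just fzero ∷ v)) vs
    ≡⟨ cong (_+_ _) (count-cong (isRow1Placement-rook j r) vs) ⟩
  count (P (suc j) (suc r)) vs + count (λ v → b ∧ P (suc j) r v) vs
    ≡⟨ cong (_+_ _) (count-∧ˡ b (P (suc j) r) vs) ⟩
  count (P (suc j) (suc r)) vs + indicator b * count (P (suc j) r) vs
    ≡⟨ cong₂ (λ x y → x + indicator b * y)
             (count-isRow1Placement m (suc j) (suc r)) (count-isRow1Placement m (suc j) r) ⟩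
  s C suc r + indicator b * (s C r)
    ≡⟨ [b+n]C[1+k]≡nC[1+k]+b*nCk (indicator≤1 b) s r ⟨
  (indicator b + s) C suc r ∎
  where
  P : ∀ {k} → ℕ → ℕ → Vec (Maybe (Fin (suc n))) k → Bool
  P = isRow1Placement (suc n)
  vs : List (Vec (Maybe (Fin (suc n))) m)
  vs = allVecs m (suc n)
  b : Bool
  b = shaded (suc n) 1 j
  s : ℕ
  s = shadedInRow1 (suc n) (suc j) m

-- (1, j+1) has m - 1 squares below it, and lies off the board when m = 0.
indicator-shaded-row1 : ∀ j m → indicator (shaded (j + suc m) 1 (suc j)) ≡ m % 2
indicator-shaded-row1 (suc j) m                   = indicator-shaded-row1 j m
indicator-shaded-row1 zero    zero                = refl
indicator-shaded-row1 zero    (suc zero)          = refl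
indicator-shaded-row1 zero    (suc (suc zero))    = refl
indicator-shaded-row1 zero    (suc (suc (suc m))) = indicator-shaded-row1 zero (suc m)

shadedInRow1-tail : ∀ j m → shadedInRow1 (j + m) (suc j) m ≡ ⌊ m /2⌋
shadedInRow1-tail j zero    = refl
shadedInRow1-tail j (suc m) = begin
  indicator (shaded (j + suc m) 1 (suc j)) + shadedInRow1 (j + suc m) (suc (suc j)) m
    ≡⟨ cong₂ _+_ (indicator-shaded-row1 j m)
                 (cong (λ N → shadedInRow1 N (suc (suc j)) m) (+-suc j m)) ⟩
  m % 2 + shadedInRow1 (suc j + m) (suc (suc j)) m
    ≡⟨ cong (_+_ (m % 2)) (shadedInRow1-tail (suc j) m) ⟩
  m % 2 + ⌊ m /2⌋
    ≡⟨ ⌊1+n/2⌋≡n%2+⌊n/2⌋ m ⟨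
  ⌊ suc m /2⌋ ∎

countAR-row1-closed : ∀ n r → countAR-row1 (suc n) r ≡ ⌊ suc n /2⌋ C r
countAR-row1-closed n r =
  trans (count-isRow1Placement (suc n) 1 r) (cong (_C r) (shadedInRow1-tail 0 (suc n)))

corollary7p5 : (n k : ℕ) → 1 ≤ n → k ≤ n →
    (cq -[1+ 0 ] n k ≡ + countAR-row1 n (n ∸ k))
      × (cq -[1+ 0 ] n k ≡ + (⌊ n /2⌋ C (n ∸ k)))
corollary7p5 (suc n) k _ k≤n =
  trans closed (cong +_ (sym (countAR-row1-closed n (suc n ∸ k)))) , closed
  where
  closed : cq -1ℤ (suc n) k ≡ + (⌊ suc n /2⌋ C (suc n ∸ k))
  closed = cq-−1-closed k≤n
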